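{- Let $d\ge 1$. For every $1\le k\le d$, all coefficients of $Q_{d,k}(x)$ are even integers.
   Context: For $j\ge 0$ let $g(L_j,x)=\sum_{m=0}^{\lfloor j/2\rfloor}\frac{1}{j-m+1}\binom{j}{m}\binom{2j-2m}{j}(x-1)^m$. For $1\le k\le d$, $Q_{d,k}(x)=\sum_{j=k-1}^{d}2^{d-j}\left[\binom{d-k}{d-j}+\binom{d+1-k}{d-j}\right](x-1)^{d-j}g(L_j,x)$. -}

module Defs where

open import Data.Nat using (ℕ; zero; suc; _∸_; _^_; _/_)
import Data.Nat as ℕ
open import Data.Nat.Combinatorics using (_C_)
open import Data.Integer using (ℤ; +_)
open import Data.Rational using (ℚ; 0ℚ; 1ℚ; -_)
import Data.Rational as ℚ
open import Data.List using (List; []; _∷_)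

-- Polynomials with rational coefficients, as coefficient lists
-- (constant term first).
Poly : Set
Poly = List ℚ

infixl 6 _+ᵖ_
_+ᵖ_ : Poly → Poly → Poly
[] +ᵖ q = q
(a ∷ p) +ᵖ [] = a ∷ p
(a ∷ p) +ᵖ (b ∷ q) = (a ℚ.+ b) ∷ (p +ᵖ q)

_·ᵖ_ : ℚ → Poly → Poly
c ·ᵖ [] = []
c ·ᵖ (a ∷ p) = (c ℚ.* a) ∷ (c ·ᵖ p)

infixl 7 _*ᵖ_
_*ᵖ_ : Poly → Poly → Poly
[] *ᵖ q = []
(a ∷ p) *ᵖ q = (a ·ᵖ q) +ᵖ (0ℚ ∷ (p *ᵖ q))

oneᵖ : Poly
oneᵖ = 1ℚ ∷ []

xm1 : Poly
xm1 = (- 1ℚ) ∷ 1ℚ ∷ []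

_^ᵖ_ : Poly → ℕ → Poly
p ^ᵖ zero = oneᵖ
p ^ᵖ suc n = p *ᵖ (p ^ᵖ n)

coeff : Poly → ℕ → ℚ
coeff [] i = 0ℚ
coeff (a ∷ p) zero = a
coeff (a ∷ p) (suc i) = coeff p i

ℕ→ℚ : ℕ → ℚ
ℕ→ℚ n = + n ℚ./ 1

sumFrom : ℕ → ℕ → (ℕ → Poly) → Poly
sumFrom a zero f = []
sumFrom a (suc len) f = f a +ᵖ sumFrom (suc a) len f

-- Σ_{i=lo}^{hi} f i  (empty if hi < lo)
sumRange : ℕ → ℕ → (ℕ → Poly) → Poly
sumRange lo hi f = sumFrom lo (suc hi ∸ lo) f

-- g(L_j, x) = Σ_{m=0}^{⌊j/2⌋} 1/(j-m+1) C(j,m) C(2j-2m, j) (x-1)^m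
gL : ℕ → Poly
gL j = sumRange 0 (j / 2) λ m →
  ((+ ((j C m) ℕ.* ((2 ℕ.* j ∸ 2 ℕ.* m) C j)) ℚ./ suc (j ∸ m)) ·ᵖ (xm1 ^ᵖ m))

-- Q_{d,k}(x) = Σ_{j=k-1}^{d} 2^{d-j} [C(d-k, d-j) + C(d+1-k, d-j)] (x-1)^{d-j} g(L_j, x)
Q : ℕ → ℕ → Poly
Q d k = sumRange (k ∸ 1) d λ j →
  (ℕ→ℚ (2 ^ (d ∸ j) ℕ.* (((d ∸ k) C (d ∸ j)) ℕ.+ ((suc d ∸ k) C (d ∸ j)))))
    ·ᵖ ((xm1 ^ᵖ (d ∸ j)) *ᵖ gL j)

module Submission where

-- The scalar 2^(d-j) (C(d-k,d-j) + C(d+1-k,d-j)) is always even: for j < d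
-- because of the power of two, and for j = d because it equals 1 + 1.  So it
-- suffices that every g(L_j, x) has integer coefficients.  With n = j - m, the
-- coefficient C(j,m) C(2n,j) / (n+1) of (x-1)^m vanishes when m > n, and for
-- m ≤ n both C(j,m) C(2n,j) and C(2n,n) C(n,m) count the same multinomial
-- (2n)! / (m! n! (n-m)!), so it is C(n,m) times the Catalan number
-- C(2n,n) / (n+1).

open import Defs

import Data.Nat as ℕ
open import Data.Nat using (ℕ; zero; suc; _+_; _*_; _∸_; _^_; _≤_; _<_; _!; z<s)
open import Data.Nat.Properties
open import Data.Nat.Combinatorics
  using (_C_; nCk≡n!/k![n-k]!; k![n∸k]!∣n!; [n-k]*d[k+1]≡[k+1]*d[k]; k>n⇒nCk≡0)
open import Data.Nat.Divisibility using (_∣_; divides; ∣-trans; m∣m*n; 1∣_; _∣0)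
open import Data.Nat.DivMod using (m*[n/m]≡n)
open import Data.Nat.Solver using (module +-*-Solver)
open import Data.Integer using (+_; -[1+_])
import Data.Integer as ℤ
import Data.Integer.Properties as ℤP
open import Data.Rational using (ℚ; mkℚ; _/_; 0ℚ; -_)
import Data.Rational as ℚ
open import Data.Rational.Properties using (normalize-coprime; fromℚᵘ-cong)
open import Data.Rational.Unnormalised.Base using (mkℚᵘ; *≡*)
open import Data.Nat.Coprimality using (1-coprimeTo) renaming (sym to coprime-sym)
open import Data.List.Relation.Unary.All using (All; []; _∷_)
open import Data.Product using (∃-syntax; _,_)
open import Relation.Nullary using (yes; no)
open import Relation.Binary.PropositionalEquality

open ≡-Reasoning
open +-*-Solver using (solve; _:*_; _:=_)

nCk*k![n∸k]!≡n! : ∀ {n k} → k ≤ n → (n C k) * (k ! * (n ∸ k) !) ≡ n !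
nCk*k![n∸k]!≡n! {n} {k} k≤n = begin
  (n C k) * (k ! * (n ∸ k) !)                   ≡⟨ cong (_* (k ! * (n ∸ k) !)) (nCk≡n!/k![n-k]! k≤n) ⟩
  (n ! ℕ./ (k ! * (n ∸ k) !)) * (k ! * (n ∸ k) !) ≡⟨ *-comm (n ! ℕ./ (k ! * (n ∸ k) !)) _ ⟩
  (k ! * (n ∸ k) !) * (n ! ℕ./ (k ! * (n ∸ k) !)) ≡⟨ m*[n/m]≡n (k![n∸k]!∣n! k≤n) ⟩
  n ! ∎
  where
  instance _ = k !* (n ∸ k) !≢0

[n∸k]*nCk≡[k+1]*nC[k+1] : ∀ {n k} → k < n → (n ∸ k) * (n C k) ≡ suc k * (n C suc k)
[n∸k]*nCk≡[k+1]*nC[k+1] {n} {k} k<n =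
  *-cancelʳ-≡ _ _ (k ! * (n ∸ k) !) {{k !* (n ∸ k) !≢0}} (begin
    (n ∸ k) * (n C k) * (k ! * (n ∸ k) !)
      ≡⟨ *-assoc (n ∸ k) _ _ ⟩
    (n ∸ k) * ((n C k) * (k ! * (n ∸ k) !))
      ≡⟨ cong ((n ∸ k) *_) (trans (nCk*k![n∸k]!≡n! (<⇒≤ k<n)) (sym (nCk*k![n∸k]!≡n! k<n))) ⟩
    (n ∸ k) * ((n C suc k) * (suc k ! * (n ∸ suc k) !))
      ≡⟨ solve 4 (λ a c f g → a :* (c :* (f :* g)) := c :* (a :* (f :* g))) refl
           (n ∸ k) (n C suc k) (suc k !) ((n ∸ suc k) !) ⟩
    (n C suc k) * ((n ∸ k) * (suc k ! * (n ∸ suc k) !))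
      ≡⟨ cong ((n C suc k) *_) ([n-k]*d[k+1]≡[k+1]*d[k] k<n) ⟩
    (n C suc k) * (suc k * (k ! * (n ∸ k) !))
      ≡⟨ solve 3 (λ c s d → c :* (s :* d) := s :* c :* d) refl (n C suc k) (suc k) (k ! * (n ∸ k) !) ⟩
    suc k * (n C suc k) * (k ! * (n ∸ k) !) ∎)

2*n∸n≡n : ∀ n → 2 * n ∸ n ≡ n
2*n∸n≡n n = trans (cong (λ t → n + t ∸ n) (+-identityʳ n)) (m+n∸n≡m n n)

2*n∸[m+n]≡n∸m : ∀ m n → 2 * n ∸ (m + n) ≡ n ∸ m
2*n∸[m+n]≡n∸m m n = begin
  n + (n + 0) ∸ (m + n) ≡⟨ cong₂ (λ a b → n + a ∸ b) (+-identityʳ n) (+-comm m n) ⟩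
  n + n ∸ (n + m)       ≡⟨ [m+n]∸[m+o]≡n∸o n n m ⟩
  n ∸ m                 ∎

n≤2*n : ∀ n → n ≤ 2 * n
n≤2*n n = m≤m+n n (n + 0)

[n+1]∣[2n]Cn : ∀ n → suc n ∣ (2 * n) C n
[n+1]∣[2n]Cn zero = 1∣ 1
[n+1]∣[2n]Cn n@(suc _) = divides (A ∸ B) (sym (begin
  (A ∸ B) * suc n           ≡⟨ *-distribʳ-∸ (suc n) A B ⟩
  A * suc n ∸ B * suc n     ≡⟨ cong₂ _∸_ (*-suc A n) (*-comm B (suc n)) ⟩
  A + A * n ∸ suc n * B     ≡⟨ cong₂ (λ a b → A + a ∸ b) (*-comm A n) (sym nA≡[n+1]B) ⟩
  A + n * A ∸ n * A         ≡⟨ m+n∸n≡m A (n * A) ⟩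
  A                         ∎))
  where
  A = (2 * n) C n
  B = (2 * n) C suc n
  nA≡[n+1]B : n * A ≡ suc n * B
  nA≡[n+1]B = trans (cong (_* A) (sym (2*n∸n≡n n))) ([n∸k]*nCk≡[k+1]*nC[k+1] (m<m+n n z<s))

nCj*jCm*m![j∸m]![n∸j]!≡n! : ∀ {n j m} → m ≤ j → j ≤ n →
  (n C j) * (j C m) * (m ! * (j ∸ m) ! * (n ∸ j) !) ≡ n !
nCj*jCm*m![j∸m]![n∸j]!≡n! {n} {j} {m} m≤j j≤n = begin
  (n C j) * (j C m) * (m ! * (j ∸ m) ! * (n ∸ j) !)
    ≡⟨ solve 5 (λ a b c d e → a :* b :* (c :* d :* e) := a :* (b :* (c :* d) :* e)) refl
         (n C j) (j C m) (m !) ((j ∸ m) !) ((n ∸ j) !) ⟩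
  (n C j) * ((j C m) * (m ! * (j ∸ m) !) * (n ∸ j) !)
    ≡⟨ cong (λ t → (n C j) * (t * (n ∸ j) !)) (nCk*k![n∸k]!≡n! m≤j) ⟩
  (n C j) * (j ! * (n ∸ j) !)
    ≡⟨ nCk*k![n∸k]!≡n! j≤n ⟩
  n ! ∎

-- Both sides count (2n)! / (m! n! (n-m)!).
[2n]C[m+n]*[m+n]Cm≡[2n]Cn*nCm : ∀ {m n} → m ≤ n →
  ((2 * n) C (m + n)) * ((m + n) C m) ≡ ((2 * n) C n) * (n C m)
[2n]C[m+n]*[m+n]Cm≡[2n]Cn*nCm {m} {n} m≤n =
  *-cancelʳ-≡ _ _ (m ! * n ! * (n ∸ m) !) (trans left (sym right))
  where
  instance _ = m*n≢0 (m ! * n !) ((n ∸ m) !) {{m !* n !≢0}} {{(n ∸ m) !≢0}}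
  left : ((2 * n) C (m + n)) * ((m + n) C m) * (m ! * n ! * (n ∸ m) !) ≡ (2 * n) !
  left = subst₂ (λ a b → ((2 * n) C (m + n)) * ((m + n) C m) * (m ! * a ! * b !) ≡ (2 * n) !)
    (m+n∸m≡n m n) (2*n∸[m+n]≡n∸m m n)
    (nCj*jCm*m![j∸m]![n∸j]!≡n! (m≤m+n m n)
      (subst (m + n ≤_) (cong (λ t → n + t) (sym (+-identityʳ n))) (+-monoˡ-≤ n m≤n)))
  right : ((2 * n) C n) * (n C m) * (m ! * n ! * (n ∸ m) !) ≡ (2 * n) !
  right = begin
    ((2 * n) C n) * (n C m) * (m ! * n ! * (n ∸ m) !)
      ≡⟨ cong (((2 * n) C n) * (n C m) *_)
           (solve 3 (λ a b c → a :* b :* c := a :* c :* b) refl (m !) (n !) ((n ∸ m) !)) ⟩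
    ((2 * n) C n) * (n C m) * (m ! * (n ∸ m) ! * n !)
      ≡⟨ cong (λ t → ((2 * n) C n) * (n C m) * (m ! * (n ∸ m) ! * t !)) (sym (2*n∸n≡n n)) ⟩
    ((2 * n) C n) * (n C m) * (m ! * (n ∸ m) ! * (2 * n ∸ n) !)
      ≡⟨ nCj*jCm*m![j∸m]![n∸j]!≡n! m≤n (n≤2*n n) ⟩
    (2 * n) ! ∎

[n+1]∣[m+n]Cm*[2n]C[m+n] : ∀ m n → suc n ∣ ((m + n) C m) * ((2 * n) C (m + n))
[n+1]∣[m+n]Cm*[2n]C[m+n] m n with m ≤? n
... | yes m≤n = subst (suc n ∣_) (begin
  ((2 * n) C n) * (n C m)             ≡⟨ [2n]C[m+n]*[m+n]Cm≡[2n]Cn*nCm m≤n ⟨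
  ((2 * n) C (m + n)) * ((m + n) C m) ≡⟨ *-comm ((2 * n) C (m + n)) _ ⟩
  ((m + n) C m) * ((2 * n) C (m + n)) ∎)
  (∣-trans ([n+1]∣[2n]Cn n) (m∣m*n (n C m)))
... | no m≰n = subst (suc n ∣_)
  (sym (trans (cong (((m + n) C m) *_) (k>n⇒nCk≡0 2n<m+n)) (*-zeroʳ ((m + n) C m))))
  (suc n ∣0)
  where
  2n<m+n : 2 * n < m + n
  2n<m+n = subst (_< m + n) (cong (λ t → n + t) (sym (+-identityʳ n))) (+-monoˡ-< n (≰⇒> m≰n))

[j∸m+1]∣jCm*[2j∸2m]Cj : ∀ j m → suc (j ∸ m) ∣ (j C m) * ((2 * j ∸ 2 * m) C j)
[j∸m+1]∣jCm*[2j∸2m]Cj j m with m ≤? j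
... | no m≰j rewrite m≤n⇒m∸n≡0 (<⇒≤ (≰⇒> m≰j)) = 1∣ _
... | yes m≤j rewrite sym (*-distribˡ-∸ 2 j m) =
  subst (λ i → suc (j ∸ m) ∣ (i C m) * ((2 * (j ∸ m)) C i)) (m+[n∸m]≡n m≤j)
    ([n+1]∣[m+n]Cm*[2n]C[m+n] m (j ∸ m))

IsIntegral : ℚ → Set
IsIntegral q = ∃[ z ] q ≡ z / 1

IsEven : ℚ → Set
IsEven q = ∃[ z ] q ≡ (+ 2 ℤ.* z) / 1

z/1≡mkℚ : ∀ z → z / 1 ≡ mkℚ z 0 (coprime-sym (1-coprimeTo ℤ.∣ z ∣))
z/1≡mkℚ (+ n)    = normalize-coprime (coprime-sym (1-coprimeTo n))
z/1≡mkℚ -[1+ n ] = cong -_ (normalize-coprime (coprime-sym (1-coprimeTo (suc n))))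

/1-+ : ∀ z w → (z / 1) ℚ.+ (w / 1) ≡ (z ℤ.+ w) / 1
/1-+ z w = trans (cong₂ ℚ._+_ (z/1≡mkℚ z) (z/1≡mkℚ w))
  (cong₂ (λ a b → (a ℤ.+ b) / 1) (ℤP.*-identityʳ z) (ℤP.*-identityʳ w))

/1-* : ∀ z w → (z / 1) ℚ.* (w / 1) ≡ (z ℤ.* w) / 1
/1-* z w = cong₂ ℚ._*_ (z/1≡mkℚ z) (z/1≡mkℚ w)

integral-+ : ∀ {p q} → IsIntegral p → IsIntegral q → IsIntegral (p ℚ.+ q)
integral-+ (z , refl) (w , refl) = z ℤ.+ w , /1-+ z w

integral-* : ∀ {p q} → IsIntegral p → IsIntegral q → IsIntegral (p ℚ.* q)
integral-* (z , refl) (w , refl) = z ℤ.* w , /1-* z w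

/-integral : ∀ {a n} → suc n ∣ a → IsIntegral (+ a / suc n)
/-integral {n = n} (divides q refl) = + q , fromℚᵘ-cong {mkℚᵘ (+ (q * suc n)) n} {mkℚᵘ (+ q) 0}
  (*≡* (trans (ℤP.*-identityʳ _) (ℤP.pos-* q (suc n))))

even-+ : ∀ {p q} → IsEven p → IsEven q → IsEven (p ℚ.+ q)
even-+ (z , refl) (w , refl) =
  z ℤ.+ w , trans (/1-+ (+ 2 ℤ.* z) (+ 2 ℤ.* w)) (cong (_/ 1) (sym (ℤP.*-distribˡ-+ (+ 2) z w)))

even-*ˡ : ∀ {n q} → 2 ∣ n → IsIntegral q → IsEven (ℕ→ℚ n ℚ.* q)
even-*ˡ (divides m refl) (w , refl) = + m ℤ.* w , trans (/1-* (+ (m * 2)) w) (cong (_/ 1) (begin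
  + (m * 2) ℤ.* w     ≡⟨ cong (ℤ._* w) (ℤP.pos-* m 2) ⟩
  + m ℤ.* + 2 ℤ.* w   ≡⟨ cong (ℤ._* w) (ℤP.*-comm (+ m) (+ 2)) ⟩
  + 2 ℤ.* + m ℤ.* w   ≡⟨ ℤP.*-assoc (+ 2) (+ m) w ⟩
  + 2 ℤ.* (+ m ℤ.* w) ∎))

module _ {P : ℚ → Set} (P-+ : ∀ {a b} → P a → P b → P (a ℚ.+ b)) where

  +ᵖ⁺ : ∀ {p q} → All P p → All P q → All P (p +ᵖ q)
  +ᵖ⁺ []        Pq        = Pq
  +ᵖ⁺ (Pa ∷ Pp) []        = Pa ∷ Pp
  +ᵖ⁺ (Pa ∷ Pp) (Pb ∷ Pq) = P-+ Pa Pb ∷ +ᵖ⁺ Pp Pq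

  sumFrom⁺ : ∀ {f} a len → (∀ i → All P (f i)) → All P (sumFrom a len f)
  sumFrom⁺ a zero      Pf = []
  sumFrom⁺ a (suc len) Pf = +ᵖ⁺ (Pf a) (sumFrom⁺ (suc a) len Pf)

·ᵖ⁺ : ∀ {P R : ℚ → Set} {c p} → (∀ {a} → P a → R (c ℚ.* a)) → All P p → All R (c ·ᵖ p)
·ᵖ⁺ Rc* []        = []
·ᵖ⁺ Rc* (Pa ∷ Pp) = Rc* Pa ∷ ·ᵖ⁺ Rc* Pp

*ᵖ⁺ : ∀ {p q} → All IsIntegral p → All IsIntegral q → All IsIntegral (p *ᵖ q)
*ᵖ⁺ []        Iq = []
*ᵖ⁺ (Ia ∷ Ip) Iq = +ᵖ⁺ integral-+ (·ᵖ⁺ (integral-* Ia) Iq) ((+ 0 , refl) ∷ *ᵖ⁺ Ip Iq)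

^ᵖ⁺ : ∀ {p} n → All IsIntegral p → All IsIntegral (p ^ᵖ n)
^ᵖ⁺ zero    Ip = (+ 1 , refl) ∷ []
^ᵖ⁺ (suc n) Ip = *ᵖ⁺ Ip (^ᵖ⁺ n Ip)

xm1-integral : All IsIntegral xm1
xm1-integral = (-[1+ 0 ] , refl) ∷ (+ 1 , refl) ∷ []

coeff⁺ : ∀ {P : ℚ → Set} {p} → P 0ℚ → All P p → ∀ i → P (coeff p i)
coeff⁺ P0 []        i       = P0
coeff⁺ P0 (Pa ∷ Pp) zero    = Pa
coeff⁺ P0 (Pa ∷ Pp) (suc i) = coeff⁺ P0 Pp i

gL-integral : ∀ j → All IsIntegral (gL j)
gL-integral j = sumFrom⁺ integral-+ 0 (suc (j ℕ./ 2)) λ m →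
  ·ᵖ⁺ (integral-* (/-integral ([j∸m+1]∣jCm*[2j∸2m]Cj j m))) (^ᵖ⁺ m xm1-integral)

2∣2^e*[aCe+bCe] : ∀ e a b → 2 ∣ 2 ^ e * (a C e + b C e)
2∣2^e*[aCe+bCe] zero    a b = divides 1 refl
2∣2^e*[aCe+bCe] (suc e) a b = ∣-trans (m∣m*n (2 ^ e)) (m∣m*n (a C suc e + b C suc e))

Q-even : ∀ d k → All IsEven (Q d k)
Q-even d k = sumFrom⁺ even-+ (k ∸ 1) (suc d ∸ (k ∸ 1)) λ j →
  ·ᵖ⁺ (even-*ˡ (2∣2^e*[aCe+bCe] (d ∸ j) (d ∸ k) (suc d ∸ k)))
      (*ᵖ⁺ (^ᵖ⁺ (d ∸ j) xm1-integral) (gL-integral j))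

corollary4p14 : (d k : ℕ) → 1 ≤ d → 1 ≤ k → k ≤ d →
    (i : ℕ) → ∃[ z ] coeff (Q d k) i ≡ (ℤ.+ 2 ℤ.* z) / 1
corollary4p14 d k _ _ _ = coeff⁺ (+ 0 , refl) (Q-even d k)
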